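{- Let $q$ be an odd prime power and let $\ell,d$ be integers with $0<d<2\ell$, $\ell+d$ odd and $\gcd(\ell,d)=1$. Let $\omega\in\mathbb{F}_{q^{2\ell}}\setminus\mathbb{F}_{q^\ell}$ with $\omega^{q^\ell}=-\omega$, put $\sigma=\omega^2\in\mathbb{F}_{q^\ell}$, and let $\beta$ be a nonsquare in $\mathbb{F}_{q^{2\ell}}$. Let $\overline{B}(q,\ell,d,\beta)=(\mathbb{F}_{q^{2\ell}},+,\star)$ with $$x\star y=xy^{q^\ell}+x^{q^\ell}y+\big[\beta(xy^{q^d}+x^{q^d}y)+\beta^{q^\ell}(xy^{q^d}+x^{q^d}y)^{q^\ell}\big]\omega.$$ Then the symplectic presemifield $\overline{B}(q,\ell,d,\beta)^{t*}=(\mathbb{F}_{q^{2\ell}},+,\star')$ has multiplication $$x\star' y=2Ax^{q^\ell}+2\sigma^{q^{2\ell-d}}\beta^{q^{2\ell-d}}B^{q^{2\ell-d}}x^{q^{2\ell-d}}+2\sigma\beta Bx^{q^d}$$ for all $x\in\mathbb{F}_{q^{2\ell}}$ and all $A,B\in\mathbb{F}_{q^\ell}$, where $y=A+B\omega$.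
   Context: Under the stated hypotheses $\overline{B}(q,\ell,d,\beta)$ is a commutative presemifield (a multiplication satisfying both distributive laws with no zero divisors). Write $q^{2\ell}=p^n$ with $p$ prime. Every $\mathbb{F}_p$-linear map $\varphi$ of $\mathbb{F}_{p^n}$ is uniquely $\varphi(x)=\sum_{i=0}^{n-1}\beta_ix^{p^i}$; its conjugate is $\overline{\varphi}(x)=\sum_{i=0}^{n-1}\beta_i^{p^{n-i}}x^{p^{n-i}}$. For a presemifield $\mathbb{S}=(\mathbb{F}_{p^n},+,\circ)$, the transpose $\mathbb{S}^t$ has multiplication $x\circ^t y=\overline{\varphi_y}(x)$ with $\varphi_y(x)=x\circ y$; $\mathbb{S}^{t*}$ is the dual of $\mathbb{S}^t$, i.e. $x\circ^{t*}y=y\circ^t x$. -}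

module Defs where

open import Level using (0ℓ)
open import Data.Nat as ℕ using (ℕ; zero; suc; _∸_)
open import Data.Fin using (Fin; toℕ)
open import Data.Product using (∃; _×_)
open import Relation.Nullary using (¬_)
open import Relation.Binary.PropositionalEquality using (_≡_)
open import Algebra.Structures using (IsCommutativeRing)
open import Function.Bundles using (_↔_)

record FiniteField (N : ℕ) : Set₁ where
  infixl 6 _+_
  infixl 7 _*_
  infix  8 -_
  field
    Carrier : Set
    _+_ _*_ : Carrier → Carrier → Carrier
    -_      : Carrier → Carrier
    0# 1#   : Carrier
    isCommutativeRing : IsCommutativeRing _≡_ _+_ _*_ -_ 0# 1#
    0≢1     : ¬ (0# ≡ 1#)
    inverse : ∀ x → ¬ (x ≡ 0#) → ∃ λ y → x * y ≡ 1#
    card    : Carrier ↔ Fin N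

  infixr 9 _^ᶠ_
  _^ᶠ_ : Carrier → ℕ → Carrier
  x ^ᶠ zero  = 1#
  x ^ᶠ suc m = x * (x ^ᶠ m)

  two : Carrier
  two = 1# + 1#

  Σ : ∀ {m} → (Fin m → Carrier) → Carrier
  Σ {zero}  f = 0#
  Σ {suc m} f = f Fin.zero + Σ (λ i → f (Fin.suc i))

  IsSquare : Carrier → Set
  IsSquare b = ∃ λ z → z * z ≡ b

  linPoly : (p : ℕ) {n : ℕ} → (Fin n → Carrier) → Carrier → Carrier
  linPoly p {n} c z = Σ (λ i → c i * z ^ᶠ (p ℕ.^ toℕ i))

  conjPoly : (p : ℕ) {n : ℕ} → (Fin n → Carrier) → Carrier → Carrier
  conjPoly p {n} c z = Σ (λ i → (c i ^ᶠ (p ℕ.^ (n ∸ toℕ i))) * z ^ᶠ (p ℕ.^ (n ∸ toℕ i)))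

  starB : (q ℓ d : ℕ) (β ω : Carrier) → Carrier → Carrier → Carrier
  starB q ℓ d β ω x y =
    x * y ^ᶠ (q ℕ.^ ℓ) + x ^ᶠ (q ℕ.^ ℓ) * y
    + (β * u + β ^ᶠ (q ℕ.^ ℓ) * u ^ᶠ (q ℕ.^ ℓ)) * ω
    where
    u = x * y ^ᶠ (q ℕ.^ d) + x ^ᶠ (q ℕ.^ d) * y

  starFormula : (q ℓ d : ℕ) (β ω : Carrier) → Carrier → Carrier → Carrier → Carrier
  starFormula q ℓ d β ω x A B =
    two * A * x ^ᶠ (q ℕ.^ ℓ)
    + two * σ ^ᶠ e * β ^ᶠ e * B ^ᶠ e * x ^ᶠ e
    + two * σ * β * B * x ^ᶠ (q ℕ.^ d)
    where
    σ = ω * ω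
    e = q ℕ.^ ((2 ℕ.* ℓ) ∸ d)

module Submission where

-- Write q = pᵏ, n = 2kℓ and φᵢ z = z ^ p ^ i.  As |F| = pⁿ, F has characteristic p and a ^ pⁿ = a,
-- so the φᵢ are ring endomorphisms with φ_{i+n} = φᵢ.  Using ω^{q^ℓ} = −ω, the map z ↦ z ⋆ x is a combination of just
-- four of them, at i = 0, kℓ, kd and kd + kℓ mod n; since a nonzero polynomial of degree < |F| has a
-- non-root, these four terms are the coefficients c.  In the conjugate, the terms coming from 0 and
-- kℓ (and those from kd and kd + kℓ) differ only in the sign of ω, because φ_{kℓ} fixes A and B and
-- negates ω; in their sum the parts odd in ω cancel and the even parts double.

open import Level using (0ℓ)
open import Data.Nat as ℕ using (ℕ; zero; suc; _∸_)
open import Data.Nat.Primality using (Prime)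
open import Data.Product using (_×_; _,_; proj₁; proj₂)
open import Data.Sum using (_⊎_; inj₁; inj₂; [_,_])
open import Data.Fin as Fin using (Fin; toℕ)
import Data.Fin.Properties as FinP
open import Data.Empty using (⊥-elim)
open import Function using (_∘_; id)
open import Relation.Nullary using (¬_; Dec; yes; no)
open import Relation.Binary.PropositionalEquality
  using (_≡_; _≢_; refl; sym; trans; cong; cong₂; subst; module ≡-Reasoning)
open import Algebra.Bundles using (Monoid)
import Algebra.Properties.Monoid.Sum as MonoidSum
open import Defs

module PrimeBinomial where
  open import Data.Nat
  open import Data.Nat.Properties
  open import Data.Nat.Divisibility
  open import Data.Nat.DivMod using (m/n*n≡m)
  open import Data.Nat.Primality
  open import Data.Nat.Combinatorics
  open import Data.Nat.Combinatorics.Specification using (nCk≡n!/k![n-k]!)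

  prime≥2 : ∀ {p} → Prime p → 2 ≤ p
  prime≥2 {p} pr = nonTrivial⇒n>1 p {{prime⇒nonTrivial pr}}

  prime∤m! : ∀ {p} → Prime p → ∀ m → m < p → ¬ (p ∣ m !)
  prime∤m! pr zero    m<p p∣1 = <⇒≱ (prime≥2 pr) (∣⇒≤ p∣1)
  prime∤m! pr (suc m) m<p p∣m! with euclidsLemma (suc m) (m !) pr p∣m!
  ... | inj₁ p∣m+1 = <⇒≱ m<p (∣⇒≤ p∣m+1)
  ... | inj₂ p∣m!  = prime∤m! pr m (<-trans (n<1+n m) m<p) p∣m!

  prime∣pCk : ∀ {p} → Prime p → ∀ k → 0 < k → k < p → p ∣ p C k
  prime∣pCk {suc q} pr k 0<k k<p with euclidsLemma (p C k) (k ! * (p ∸ k) !) pr p∣C*k!*[p∸k]!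
    where
    p : ℕ
    p = suc q
    instance
      k!*[p∸k]!≢0 : NonZero (k ! * (p ∸ k) !)
      k!*[p∸k]!≢0 = k !* (p ∸ k) !≢0
    p∣C*k!*[p∸k]! : p ∣ (p C k) * (k ! * (p ∸ k) !)
    p∣C*k!*[p∸k]! = subst (p ∣_)
      (sym (trans (cong (_* (k ! * (p ∸ k) !)) (nCk≡n!/k![n-k]! (<⇒≤ k<p)))
                  (m/n*n≡m (k![n∸k]!∣n! (<⇒≤ k<p)))))
      (m∣m*n (q !))
  ... | inj₁ p∣C = p∣C
  ... | inj₂ p∣k!*[p∸k]! with euclidsLemma (k !) ((suc q ∸ k) !) pr p∣k!*[p∸k]!
  ...   | inj₁ p∣k! = ⊥-elim (prime∤m! pr k k<p p∣k!)
  ...   | inj₂ p∣[p∸k]! = ⊥-elim (prime∤m! pr (suc q ∸ k) (∸-monoʳ-< 0<k (<⇒≤ k<p)) p∣[p∸k]!)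

module _ {a ℓ} (M : Monoid a ℓ) where
  open Monoid M using (Carrier; _≈_; _∙_; ε; ∙-cong; ∙-congˡ; identityˡ; identityʳ; setoid)
  open MonoidSum M using (sum; sum-cong-≋; sum-replicate-zero)
  open import Relation.Binary.Reasoning.Setoid setoid

  sum-single : ∀ {m} (f : Fin m → Carrier) j → (∀ i → i ≢ j → f i ≈ ε) → sum f ≈ f j
  sum-single {suc m} f Fin.zero f≈ε = begin
    f Fin.zero ∙ sum (f ∘ Fin.suc)  ≈⟨ ∙-congˡ (sum-cong-≋ {m} (λ i → f≈ε (Fin.suc i) (λ ()))) ⟩
    f Fin.zero ∙ sum {m} (λ _ → ε)  ≈⟨ ∙-congˡ (sum-replicate-zero m) ⟩
    f Fin.zero ∙ ε                  ≈⟨ identityʳ _ ⟩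
    f Fin.zero                      ∎
  sum-single {suc m} f (Fin.suc j) f≈ε = begin
    f Fin.zero ∙ sum (f ∘ Fin.suc)
      ≈⟨ ∙-cong (f≈ε Fin.zero (λ ())) (sum-single (f ∘ Fin.suc) j (λ i i≢j → f≈ε (Fin.suc i) (i≢j ∘ FinP.suc-injective))) ⟩
    ε ∙ f (Fin.suc j)
      ≈⟨ identityˡ _ ⟩
    f (Fin.suc j) ∎

module FieldArithmetic {N : ℕ} (F : FiniteField N) where

  open import Algebra.Bundles using (CommutativeRing)
  open import Algebra.Solver.Ring.AlmostCommutativeRing using (fromCommutativeRing; _-Raw-AlmostCommutative⟶_)
  open import Data.Integer as ℤ using (ℤ; -[1+_]; _⊖_)
  open import Data.Integer public using (0ℤ; 1ℤ)
  import Data.Integer.Properties as ℤ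
  import Data.Nat.Properties as ℕP
  open import Data.Maybe using (Maybe; just; nothing)
  open import Data.Sign as Sign using (Sign)
  open import Function.Bundles using (Inverse)

  open FiniteField F public

  commutativeRing : CommutativeRing 0ℓ 0ℓ
  commutativeRing = record { isCommutativeRing = isCommutativeRing }

  open CommutativeRing commutativeRing public
    using (+-comm; +-assoc; *-comm; *-assoc; +-identityˡ; +-identityʳ; *-identityˡ; *-identityʳ;
           zeroˡ; zeroʳ; distribˡ; distribʳ; -‿inverseˡ; -‿inverseʳ;
           semiring; commutativeSemiring; +-monoid; *-monoid; +-commutativeMonoid; *-commutativeMonoid)
  open import Algebra.Properties.Ring (CommutativeRing.ring commutativeRing) public
    using (-‿involutive; -0#≈0#; -‿+-comm; -1*x≈-x; x∙y⁻¹≈ε⇒x≈y;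
           +-identityʳ-unique; +-inverseʳ-unique; x+x≈x⇒x≈0)
  open import Algebra.Properties.Semiring.Mult.TCOptimised semiring public
    using (1+×; ×-homo-+; ×1-homo-*; ×ᵤ≈×) renaming (_×_ to _×′_)
  open import Algebra.Properties.CommutativeSemigroup (CommutativeRing.*-commutativeSemigroup commutativeRing)
    using () renaming (interchange to *-interchange)
  open import Algebra.Properties.Semiring.Exp semiring public using (_^_)
  open import Algebra.Properties.Semiring.Exp semiring using (^-assocʳ)
  open import Algebra.Properties.CommutativeSemiring.Exp commutativeSemiring using (^-distrib-*)

  infixl 6 _-_
  _-_ : Carrier → Carrier → Carrier
  x - y = x + - y

  -- The optimised ×′ makes nat 1 reduce to 1#, so that the solver's constant 1ℤ denotes 1#.
  nat : ℕ → Carrier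
  nat n = n ×′ 1#

  module IntegerCoefficients where

    sign : Sign → Carrier
    sign Sign.+ = 1#
    sign Sign.- = - 1#

    ⟦_⟧ : ℤ → Carrier
    ⟦ ℤ.+ n ⟧      = nat n
    ⟦ -[1+ n ] ⟧ = - nat (suc n)

    ⟦⊖⟧ : ∀ m n → ⟦ m ⊖ n ⟧ ≡ nat m - nat n
    ⟦⊖⟧ m       zero    = sym (trans (cong (nat m +_) -0#≈0#) (+-identityʳ _))
    ⟦⊖⟧ zero    (suc n) = sym (+-identityˡ _)
    ⟦⊖⟧ (suc m) (suc n) = begin
      ⟦ suc m ⊖ suc n ⟧                     ≡⟨ cong ⟦_⟧ (ℤ.[1+m]⊖[1+n]≡m⊖n m n) ⟩
      ⟦ m ⊖ n ⟧                             ≡⟨ ⟦⊖⟧ m n ⟩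
      nat m - nat n                         ≡⟨ cong (_- nat n) (sym (cancelˡ 1# (nat m))) ⟩
      - 1# + (1# + nat m) - nat n           ≡⟨ cong (_- nat n) (+-comm (- 1#) _) ⟩
      (1# + nat m) + - 1# + - nat n         ≡⟨ +-assoc _ (- 1#) _ ⟩
      (1# + nat m) + (- 1# + - nat n)       ≡⟨ cong₂ (λ a b → a + b) (sym (1+× m 1#)) (-‿+-comm 1# (nat n)) ⟩
      nat (suc m) + - (1# + nat n)          ≡⟨ cong (λ a → nat (suc m) - a) (sym (1+× n 1#)) ⟩
      nat (suc m) - nat (suc n)             ∎
      where
      open ≡-Reasoning
      cancelˡ : ∀ a b → - a + (a + b) ≡ b
      cancelˡ a b = trans (sym (+-assoc (- a) a b)) (trans (cong (_+ b) (-‿inverseˡ a)) (+-identityˡ b))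

    ⟦+⟧ : ∀ i j → ⟦ i ℤ.+ j ⟧ ≡ ⟦ i ⟧ + ⟦ j ⟧
    ⟦+⟧ (ℤ.+ m)      (ℤ.+ n)      = ×-homo-+ 1# m n
    ⟦+⟧ (ℤ.+ m)      -[1+ n ]   = ⟦⊖⟧ m (suc n)
    ⟦+⟧ -[1+ m ]   (ℤ.+ n)      = trans (⟦⊖⟧ n (suc m)) (+-comm _ _)
    ⟦+⟧ -[1+ m ]   -[1+ n ]   = begin
      - nat (suc (suc (m ℕ.+ n)))           ≡⟨ cong (λ k → - nat k) (sym (ℕP.+-suc (suc m) n)) ⟩
      - nat (suc m ℕ.+ suc n)               ≡⟨ cong -_ (×-homo-+ 1# (suc m) (suc n)) ⟩
      - (nat (suc m) + nat (suc n))         ≡⟨ sym (-‿+-comm _ _) ⟩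
      - nat (suc m) + - nat (suc n)         ∎
      where
      open ≡-Reasoning

    ⟦-⟧ : ∀ i → ⟦ ℤ.- i ⟧ ≡ - ⟦ i ⟧
    ⟦-⟧ -[1+ n ]     = sym (-‿involutive _)
    ⟦-⟧ (ℤ.+ zero)     = sym -0#≈0#
    ⟦-⟧ (ℤ.+ (suc n))  = refl

    ⟦◃⟧ : ∀ s n → ⟦ s ℤ.◃ n ⟧ ≡ sign s * nat n
    ⟦◃⟧ s        zero    = sym (zeroʳ _)
    ⟦◃⟧ Sign.+   (suc n) = sym (*-identityˡ _)
    ⟦◃⟧ Sign.-   (suc n) = sym (-1*x≈-x _)

    sign-* : ∀ s t → sign (s Sign.* t) ≡ sign s * sign t
    sign-* Sign.+ t      = sym (*-identityˡ _)
    sign-* Sign.- Sign.+ = sym (*-identityʳ _)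
    sign-* Sign.- Sign.- = sym (trans (-1*x≈-x (- 1#)) (-‿involutive 1#))

    ⟦sign◃∣∣⟧ : ∀ i → ⟦ i ⟧ ≡ sign (ℤ.sign i) * nat ℤ.∣ i ∣
    ⟦sign◃∣∣⟧ i = trans (cong ⟦_⟧ (sym (ℤ.◃-inverse i))) (⟦◃⟧ (ℤ.sign i) ℤ.∣ i ∣)

    ⟦*⟧ : ∀ i j → ⟦ i ℤ.* j ⟧ ≡ ⟦ i ⟧ * ⟦ j ⟧
    ⟦*⟧ i j = begin
      ⟦ (ℤ.sign i Sign.* ℤ.sign j) ℤ.◃ (ℤ.∣ i ∣ ℕ.* ℤ.∣ j ∣) ⟧
        ≡⟨ ⟦◃⟧ (ℤ.sign i Sign.* ℤ.sign j) (ℤ.∣ i ∣ ℕ.* ℤ.∣ j ∣) ⟩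
      sign (ℤ.sign i Sign.* ℤ.sign j) * nat (ℤ.∣ i ∣ ℕ.* ℤ.∣ j ∣)
        ≡⟨ cong₂ _*_ (sign-* (ℤ.sign i) (ℤ.sign j)) (×1-homo-* ℤ.∣ i ∣ ℤ.∣ j ∣) ⟩
      (sign (ℤ.sign i) * sign (ℤ.sign j)) * (nat ℤ.∣ i ∣ * nat ℤ.∣ j ∣)
        ≡⟨ *-interchange _ _ _ _ ⟩
      (sign (ℤ.sign i) * nat ℤ.∣ i ∣) * (sign (ℤ.sign j) * nat ℤ.∣ j ∣)
        ≡⟨ sym (cong₂ _*_ (⟦sign◃∣∣⟧ i) (⟦sign◃∣∣⟧ j)) ⟩
      ⟦ i ⟧ * ⟦ j ⟧ ∎
      where open ≡-Reasoning

    morphism : ℤ.+-*-rawRing -Raw-AlmostCommutative⟶ fromCommutativeRing commutativeRing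
    morphism = record
      { ⟦_⟧ = ⟦_⟧ ; +-homo = ⟦+⟧ ; *-homo = ⟦*⟧ ; -‿homo = ⟦-⟧ ; 0-homo = refl ; 1-homo = refl }

    _≟ℤ_ : ∀ i j → Maybe (⟦ i ⟧ ≡ ⟦ j ⟧)
    i ≟ℤ j with i ℤ.≟ j
    ... | yes i≡j = just (cong ⟦_⟧ i≡j)
    ... | no _    = nothing

  open import Algebra.Solver.Ring ℤ.+-*-rawRing (fromCommutativeRing commutativeRing)
    IntegerCoefficients.morphism IntegerCoefficients._≟ℤ_ public
    using (solve; _:=_; _:+_; _:*_; :-_; _:-_; con)

  element : Fin N → Carrier
  element = Inverse.from card

  index : Carrier → Fin N
  index = Inverse.to card

  element-index : ∀ x → element (index x) ≡ x
  element-index = Inverse.strictlyInverseʳ card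

  index-element : ∀ i → index (element i) ≡ i
  index-element = Inverse.strictlyInverseˡ card

  element-injective : ∀ {i j} → element i ≡ element j → i ≡ j
  element-injective {i} {j} e = trans (sym (index-element i)) (trans (cong index e) (index-element j))

  infix 4 _≟_
  _≟_ : (x y : Carrier) → Dec (x ≡ y)
  x ≟ y with index x Fin.≟ index y
  ... | yes e = yes (trans (sym (element-index x)) (trans (cong element e) (element-index y)))
  ... | no ne = no (λ e → ne (cong index e))

  x-y≡0⇒x≡y : ∀ {x y} → x - y ≡ 0# → x ≡ y
  x-y≡0⇒x≡y {x} {y} = x∙y⁻¹≈ε⇒x≈y x y

  noZeroDivisors : ∀ {x y} → x * y ≡ 0# → x ≡ 0# ⊎ y ≡ 0#
  noZeroDivisors {x} {y} xy≡0 with x ≟ 0#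
  ... | yes x≡0 = inj₁ x≡0
  ... | no  x≢0 = inj₂ (begin
    y                ≡⟨ sym (*-identityˡ y) ⟩
    1# * y           ≡⟨ cong (_* y) (sym (proj₂ (inverse x x≢0))) ⟩
    (x * x⁻¹) * y    ≡⟨ solve 3 (λ x x⁻¹ y → (x :* x⁻¹) :* y := x⁻¹ :* (x :* y)) refl x x⁻¹ y ⟩
    x⁻¹ * (x * y)    ≡⟨ cong (x⁻¹ *_) xy≡0 ⟩
    x⁻¹ * 0#         ≡⟨ zeroʳ x⁻¹ ⟩
    0#               ∎)
    where
    open ≡-Reasoning
    x⁻¹ : Carrier
    x⁻¹ = proj₁ (inverse x x≢0)

  *-≢0 : ∀ {x y} → x ≢ 0# → y ≢ 0# → x * y ≢ 0#
  *-≢0 x≢0 y≢0 xy≡0 = [ x≢0 , y≢0 ] (noZeroDivisors xy≡0)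

  x*y≡0⇒y≡0 : ∀ {x y} → x ≢ 0# → x * y ≡ 0# → y ≡ 0#
  x*y≡0⇒y≡0 x≢0 xy≡0 = [ ⊥-elim ∘ x≢0 , id ] (noZeroDivisors xy≡0)

  *-cancelʳ : ∀ {x y z} → z ≢ 0# → x * z ≡ y * z → x ≡ y
  *-cancelʳ {x} {y} {z} z≢0 xz≡yz = x-y≡0⇒x≡y (x*y≡0⇒y≡0 z≢0 (begin
    z * (x - y)     ≡⟨ solve 3 (λ x y z → z :* (x :- y) := x :* z :- y :* z) refl x y z ⟩
    x * z - y * z   ≡⟨ cong (_- y * z) xz≡yz ⟩
    y * z - y * z   ≡⟨ -‿inverseʳ _ ⟩
    0#              ∎))
    where open ≡-Reasoning

  ^ᶠ≗^ : ∀ x m → x ^ᶠ m ≡ x ^ m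
  ^ᶠ≗^ x zero    = refl
  ^ᶠ≗^ x (suc m) = cong (x *_) (^ᶠ≗^ x m)

  ^ᶠ-* : ∀ x a b → x ^ᶠ (a ℕ.* b) ≡ (x ^ᶠ a) ^ᶠ b
  ^ᶠ-* x a b = begin
    x ^ᶠ (a ℕ.* b)  ≡⟨ ^ᶠ≗^ x (a ℕ.* b) ⟩
    x ^ (a ℕ.* b)   ≡⟨ sym (^-assocʳ x a b) ⟩
    (x ^ a) ^ b     ≡⟨ cong (_^ b) (sym (^ᶠ≗^ x a)) ⟩
    (x ^ᶠ a) ^ b    ≡⟨ sym (^ᶠ≗^ (x ^ᶠ a) b) ⟩
    (x ^ᶠ a) ^ᶠ b   ∎
    where open ≡-Reasoning

  *-^ᶠ : ∀ x y a → (x * y) ^ᶠ a ≡ x ^ᶠ a * y ^ᶠ a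
  *-^ᶠ x y a = trans (^ᶠ≗^ (x * y) a) (trans (^-distrib-* x y a) (sym (cong₂ _*_ (^ᶠ≗^ x a) (^ᶠ≗^ y a))))

  ^ᶠ-≢0 : ∀ {x} a → x ≢ 0# → x ^ᶠ a ≢ 0#
  ^ᶠ-≢0 zero    x≢0 = 0≢1 ∘ sym
  ^ᶠ-≢0 (suc a) x≢0 = *-≢0 x≢0 (^ᶠ-≢0 a x≢0)

module FieldSums {N : ℕ} (F : FiniteField N) where

  open FieldArithmetic F
  open import Data.List using (List; []; _∷_)
  open import Data.List.Relation.Unary.All using (All; []; _∷_)
  open import Data.Fin.Permutation using (Permutation; permutation)
  import Algebra.Properties.CommutativeMonoid.Sum as CommutativeMonoidSum
  module Sum = CommutativeMonoidSum +-commutativeMonoid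
  module Product = CommutativeMonoidSum *-commutativeMonoid

  Σ≗sum : ∀ {m} (f : Fin m → Carrier) → Σ f ≡ Sum.sum f
  Σ≗sum {zero}  f = refl
  Σ≗sum {suc m} f = cong (f Fin.zero +_) (Σ≗sum (f ∘ Fin.suc))

  Σ-cong : ∀ {m} {f g : Fin m → Carrier} → (∀ i → f i ≡ g i) → Σ f ≡ Σ g
  Σ-cong {zero}  f≗g = refl
  Σ-cong {suc m} f≗g = cong₂ _+_ (f≗g Fin.zero) (Σ-cong (f≗g ∘ Fin.suc))

  Σ-+ : ∀ {m} (f g : Fin m → Carrier) → Σ (λ i → f i + g i) ≡ Σ f + Σ g
  Σ-+ f g = trans (Σ≗sum (λ i → f i + g i)) (trans (Sum.∑-distrib-+ f g) (sym (cong₂ _+_ (Σ≗sum f) (Σ≗sum g))))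

  Σ-- : ∀ {m} (f g : Fin m → Carrier) → Σ (λ i → f i - g i) ≡ Σ f - Σ g
  Σ-- {zero}  f g = sym (trans (cong (0# +_) -0#≈0#) (+-identityʳ 0#))
  Σ-- {suc m} f g = trans (cong (f Fin.zero - g Fin.zero +_) (Σ-- (f ∘ Fin.suc) (g ∘ Fin.suc)))
    (solve 4 (λ a b s t → a :- b :+ (s :- t) := a :+ s :- (b :+ t)) refl _ _ _ _)

  Σ-single : ∀ {m} (f : Fin m → Carrier) j → (∀ i → i ≢ j → f i ≡ 0#) → Σ f ≡ f j
  Σ-single f j f≡0 = trans (Σ≗sum f) (sum-single +-monoid f j f≡0)

  Σ-1 : ∀ m → Σ {m} (λ _ → 1#) ≡ nat m
  Σ-1 zero    = refl
  Σ-1 (suc m) = trans (cong (1# +_) (Σ-1 m)) (sym (1+× m 1#))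

  Σ-0 : ∀ m → Σ {m} (λ _ → 0#) ≡ 0#
  Σ-0 zero    = refl
  Σ-0 (suc m) = trans (+-identityˡ _) (Σ-0 m)

  *-Σ : ∀ {m} c (f : Fin m → Carrier) → c * Σ f ≡ Σ (λ i → c * f i)
  *-Σ {zero}  c f = zeroʳ c
  *-Σ {suc m} c f = trans (distribˡ c _ _) (cong (c * f Fin.zero +_) (*-Σ c (f ∘ Fin.suc)))

  Σ-*ʳ : ∀ {m} (f : Fin m → Carrier) c → Σ f * c ≡ Σ (λ i → f i * c)
  Σ-*ʳ f c = trans (*-comm _ c) (trans (*-Σ c f) (Σ-cong (λ i → *-comm c (f i))))

  Σ-comm : ∀ {m n} (f : Fin m → Fin n → Carrier) → Σ (λ i → Σ (λ j → f i j)) ≡ Σ (λ j → Σ (λ i → f i j))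
  Σ-comm {zero}  {n} f = sym (Σ-0 n)
  Σ-comm {suc m} {n} f = trans (cong (Σ (f Fin.zero) +_) (Σ-comm (f ∘ Fin.suc)))
                               (sym (Σ-+ (f Fin.zero) (λ j → Σ (λ i → f (Fin.suc i) j))))

  Π : ∀ {m} → (Fin m → Carrier) → Carrier
  Π = Product.sum

  Π-const : ∀ m a → Π {m} (λ _ → a) ≡ a ^ᶠ m
  Π-const zero    a = refl
  Π-const (suc m) a = cong (a *_) (Π-const m a)

  Π-≢0 : ∀ {m} (f : Fin m → Carrier) → (∀ i → f i ≢ 0#) → Π f ≢ 0#
  Π-≢0 {zero}  f f≢0 = 0≢1 ∘ sym
  Π-≢0 {suc m} f f≢0 = *-≢0 (f≢0 Fin.zero) (Π-≢0 (f ∘ Fin.suc) (f≢0 ∘ Fin.suc))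

  carrierPermutation : (g h : Carrier → Carrier) → (∀ x → g (h x) ≡ x) → (∀ x → h (g x) ≡ x) → Permutation N N
  carrierPermutation g h gh hg = permutation (index ∘ g ∘ element) (index ∘ h ∘ element)
    (λ i → trans (cong (index ∘ g) (element-index _)) (trans (cong index (gh (element i))) (index-element i)))
    (λ i → trans (cong (index ∘ h) (element-index _)) (trans (cong index (hg (element i))) (index-element i)))

  module _ (g h : Carrier → Carrier) (gh : ∀ x → g (h x) ≡ x) (hg : ∀ x → h (g x) ≡ x) where

    Σ-reindex : (f : Carrier → Carrier) → Σ (f ∘ element) ≡ Σ (f ∘ g ∘ element)
    Σ-reindex f = begin
      Σ (f ∘ element)                         ≡⟨ Σ≗sum (f ∘ element) ⟩
      Sum.sum (f ∘ element)                   ≡⟨ Sum.sum-permute (f ∘ element) (carrierPermutation g h gh hg) ⟩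
      Sum.sum (f ∘ element ∘ index ∘ g ∘ element) ≡⟨ Sum.sum-cong-≗ (λ i → cong f (element-index (g (element i)))) ⟩
      Sum.sum (f ∘ g ∘ element)               ≡⟨ sym (Σ≗sum (f ∘ g ∘ element)) ⟩
      Σ (f ∘ g ∘ element)                     ∎
      where open ≡-Reasoning

    Π-reindex : (f : Carrier → Carrier) → Π (f ∘ element) ≡ Π (f ∘ g ∘ element)
    Π-reindex f = trans (Product.sum-permute (f ∘ element) (carrierPermutation g h gh hg))
                        (Product.sum-cong-≗ (λ i → cong f (element-index (g (element i)))))

  at : ℕ → Carrier → ℕ → Carrier
  at t v a with a ℕ.≟ t
  ... | yes _ = v
  ... | no  _ = 0#

  at-≡ : ∀ t v → at t v t ≡ v
  at-≡ t v with t ℕ.≟ t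
  ... | yes _   = refl
  ... | no  t≢t = ⊥-elim (t≢t refl)

  at-≢ : ∀ {t a} v → a ≢ t → at t v a ≡ 0#
  at-≢ {t} {a} v a≢t with a ℕ.≟ t
  ... | yes a≡t = ⊥-elim (a≢t a≡t)
  ... | no  _   = refl

  Σ-at : ∀ {m t} → t ℕ.< m → (G : ℕ → Carrier → Carrier) → (∀ a → G a 0# ≡ 0#) →
         ∀ v → Σ {m} (λ i → G (toℕ i) (at t v (toℕ i))) ≡ G t v
  Σ-at {m} {t} t<m G G0≡0 v = begin
    Σ {m} (λ i → G (toℕ i) (at t v (toℕ i)))  ≡⟨ Σ-single _ j off-t ⟩
    G (toℕ j) (at t v (toℕ j))            ≡⟨ cong (λ a → G a (at t v a)) (FinP.toℕ-fromℕ< t<m) ⟩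
    G t (at t v t)                        ≡⟨ cong (G t) (at-≡ t v) ⟩
    G t v                                 ∎
    where
    open ≡-Reasoning
    j : Fin m
    j = Fin.fromℕ< t<m
    off-t : ∀ i → i ≢ j → G (toℕ i) (at t v (toℕ i)) ≡ 0#
    off-t i i≢j = trans (cong (G (toℕ i)) (at-≢ v i≢t)) (G0≡0 (toℕ i))
      where
      i≢t : toℕ i ≢ t
      i≢t = i≢j ∘ FinP.toℕ-injective ∘ (λ e → trans e (sym (FinP.toℕ-fromℕ< t<m)))

  sparse : List (ℕ × Carrier) → ℕ → Carrier
  sparse []             a = 0#
  sparse ((t , v) ∷ ts) a = at t v a + sparse ts a

  sumTerms : (ℕ → Carrier → Carrier) → List (ℕ × Carrier) → Carrier
  sumTerms G []             = 0#
  sumTerms G ((t , v) ∷ ts) = G t v + sumTerms G ts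

  Σ-sparse : ∀ {m} (G : ℕ → Carrier → Carrier) → (∀ a → G a 0# ≡ 0#) → (∀ a u v → G a (u + v) ≡ G a u + G a v) →
             ∀ ts → All (λ tv → proj₁ tv ℕ.< m) ts →
             Σ {m} (λ i → G (toℕ i) (sparse ts (toℕ i))) ≡ sumTerms G ts
  Σ-sparse {m} G G0≡0 G-+ []             []            = trans (Σ-cong {m} (G0≡0 ∘ toℕ)) (Σ-0 m)
  Σ-sparse {m} G G0≡0 G-+ ((t , v) ∷ ts) (t<m ∷ ts<m) = begin
    Σ {m} (λ i → G (toℕ i) (at t v (toℕ i) + sparse ts (toℕ i)))
      ≡⟨ Σ-cong {m} (λ i → G-+ (toℕ i) (at t v (toℕ i)) (sparse ts (toℕ i))) ⟩
    Σ (λ i → head i + rest i)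
      ≡⟨ Σ-+ head rest ⟩
    Σ head + Σ rest
      ≡⟨ cong₂ _+_ (Σ-at t<m G G0≡0 v) (Σ-sparse G G0≡0 G-+ ts ts<m) ⟩
    G t v + sumTerms G ts ∎
    where
    open ≡-Reasoning
    head rest : Fin m → Carrier
    head i = G (toℕ i) (at t v (toℕ i))
    rest i = G (toℕ i) (sparse ts (toℕ i))

module CharacteristicAndFermat {N : ℕ} (F : FiniteField N) where

  open FieldArithmetic F
  open FieldSums F
  open import Algebra.Properties.Semiring.Mult semiring using () renaming (_×_ to _×ᵤ_; ×-assoc-* to ×ᵤ-assoc-*)
  import Algebra.Properties.CommutativeSemiring.Binomial commutativeSemiring as Binomial
  open import Data.Nat.Combinatorics using (nCn≡1)
  import Data.Nat.Properties as ℕP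
  open import Data.Nat.Divisibility using (_∣_; divides)
  open PrimeBinomial using (prime∣pCk)

  nat-N≡0 : nat N ≡ 0#
  nat-N≡0 = +-identityʳ-unique S (nat N) (begin
    S + nat N
      ≡⟨ cong (S +_) (sym (Σ-1 N)) ⟩
    S + Σ {N} (λ _ → 1#)
      ≡⟨ sym (Σ-+ element (λ _ → 1#)) ⟩
    Σ (λ i → element i + 1#)
      ≡⟨ sym (Σ-reindex (_+ 1#) (_- 1#) (λ x → sub-add x 1#) (λ x → add-sub x 1#) id) ⟩
    S ∎)
    where
    open ≡-Reasoning
    S : Carrier
    S = Σ element
    sub-add : ∀ x y → x - y + y ≡ x
    sub-add x y = solve 2 (λ x y → x :- y :+ y := x) refl x y
    add-sub : ∀ x y → x + y - y ≡ x
    add-sub x y = solve 2 (λ x y → x :+ y :- y := x) refl x y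

  nat-^ : ∀ a b → nat (a ℕ.^ b) ≡ nat a ^ᶠ b
  nat-^ a zero    = refl
  nat-^ a (suc b) = trans (×1-homo-* a (a ℕ.^ b)) (cong (nat a *_) (nat-^ a b))

  nat-p≡0 : ∀ p n → N ≡ p ℕ.^ n → nat p ≡ 0#
  nat-p≡0 p n N≡pⁿ with nat p ≟ 0#
  ... | yes p≡0 = p≡0
  ... | no  p≢0 = ⊥-elim (^ᶠ-≢0 n p≢0 (trans (sym (nat-^ p n)) (trans (cong nat (sym N≡pⁿ)) nat-N≡0)))

  p∣c⇒c×z≡0 : ∀ {p} → nat p ≡ 0# → ∀ {c} → p ∣ c → ∀ z → c ×ᵤ z ≡ 0#
  p∣c⇒c×z≡0 {p} p≡0 {c} (divides q c≡qp) z = begin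
    c ×ᵤ z              ≡⟨ cong (c ×ᵤ_) (sym (*-identityˡ z)) ⟩
    c ×ᵤ (1# * z)       ≡⟨ sym (×ᵤ-assoc-* c 1# z) ⟩
    (c ×ᵤ 1#) * z       ≡⟨ cong (_* z) (×ᵤ≈× c 1#) ⟩
    nat c * z           ≡⟨ cong (λ c → nat c * z) c≡qp ⟩
    nat (q ℕ.* p) * z   ≡⟨ cong (_* z) (×1-homo-* q p) ⟩
    nat q * nat p * z   ≡⟨ cong (λ t → nat q * t * z) p≡0 ⟩
    nat q * 0# * z      ≡⟨ solve 2 (λ a z → a :* con 0ℤ :* z := con 0ℤ) refl (nat q) z ⟩
    0#                  ∎
    where open ≡-Reasoning

  frobenius-+ : ∀ {p} → Prime p → nat p ≡ 0# → ∀ x y → (x + y) ^ᶠ p ≡ x ^ᶠ p + y ^ᶠ p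
  frobenius-+ {suc q} pr p≡0 x y = begin
    (x + y) ^ᶠ p
      ≡⟨ ^ᶠ≗^ (x + y) p ⟩
    (x + y) ^ p
      ≡⟨ Binomial.theorem p x y ⟩
    t Fin.zero + Sum.sum (t ∘ Fin.suc)
      ≡⟨ cong (t Fin.zero +_) (sum-single +-monoid (t ∘ Fin.suc) (Fin.fromℕ q) middle-vanishes) ⟩
    t Fin.zero + t (Fin.suc (Fin.fromℕ q))
      ≡⟨ cong₂ _+_ first last ⟩
    y ^ᶠ p + x ^ᶠ p
      ≡⟨ +-comm _ _ ⟩
    x ^ᶠ p + y ^ᶠ p ∎
    where
    open ≡-Reasoning
    p : ℕ
    p = suc q
    t : Fin (suc p) → Carrier
    t = Binomial.binomialTerm x y p
    first : t Fin.zero ≡ y ^ᶠ p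
    first = trans (+-identityʳ _) (trans (*-identityˡ _) (sym (^ᶠ≗^ y p)))
    last : t (Fin.suc (Fin.fromℕ q)) ≡ x ^ᶠ p
    last rewrite FinP.toℕ-fromℕ q | nCn≡1 p | ℕP.n∸n≡0 q =
      trans (+-identityʳ _) (trans (*-identityʳ _) (sym (^ᶠ≗^ x p)))
    middle-vanishes : ∀ i → i ≢ Fin.fromℕ q → t (Fin.suc i) ≡ 0#
    middle-vanishes i i≢q = p∣c⇒c×z≡0 p≡0 (prime∣pCk pr (suc (toℕ i)) ℕ.z<s (ℕ.s≤s i<q)) _
      where
      i<q : toℕ i ℕ.< q
      i<q = ℕP.≤∧≢⇒< (ℕP.≤-pred (FinP.toℕ<n i)) (i≢q ∘ FinP.toℕ-injective ∘ (λ e → trans e (sym (FinP.toℕ-fromℕ q))))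

  nonzero : Carrier → Carrier
  nonzero x with x ≟ 0#
  ... | yes _ = 1#
  ... | no  _ = x

  atZero : Carrier → Carrier → Carrier
  atZero a x with x ≟ 0#
  ... | yes _ = a
  ... | no  _ = 1#

  nonzero≢0 : ∀ x → nonzero x ≢ 0#
  nonzero≢0 x with x ≟ 0#
  ... | yes _   = 0≢1 ∘ sym
  ... | no  x≢0 = x≢0

  nonzero-scale : ∀ {a} → a ≢ 0# → ∀ x → nonzero (a * x) * atZero a x ≡ a * nonzero x
  nonzero-scale {a} a≢0 x with x ≟ 0# | a * x ≟ 0#
  ... | yes _   | yes _    = trans (*-identityˡ a) (sym (*-identityʳ a))
  ... | yes x≡0 | no  ax≢0 = ⊥-elim (ax≢0 (trans (cong (a *_) x≡0) (zeroʳ a)))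
  ... | no  x≢0 | yes ax≡0 = ⊥-elim (*-≢0 a≢0 x≢0 ax≡0)
  ... | no  _   | no  _    = *-identityʳ (a * x)

  atZero-element : ∀ a i → i ≢ index 0# → atZero a (element i) ≡ 1#
  atZero-element a i i≢0 with element i ≟ 0#
  ... | yes i≡0 = ⊥-elim (i≢0 (trans (sym (index-element i)) (cong index i≡0)))
  ... | no  _   = refl

  atZero-zero : ∀ a → atZero a 0# ≡ a
  atZero-zero a with 0# ≟ 0#
  ... | yes _   = refl
  ... | no  0≢0 = ⊥-elim (0≢0 refl)

  -- For a ≢ 0, x ↦ a x permutes F, so Π nonzero (a x) = Π nonzero x; comparing with
  -- Π a · nonzero x = a ^ N Π nonzero x, with atZero repairing the factor at x = 0, gives a ^ N = a.
  fermat : ∀ a → a ^ᶠ N ≡ a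
  fermat a with a ≟ 0#
  ... | yes a≡0 = trans (cong (_^ᶠ N) a≡0) (trans (0^ᶠ-inhabited (index 0#)) (sym a≡0))
    where
    0^ᶠ-inhabited : ∀ {m} → Fin m → 0# ^ᶠ m ≡ 0#
    0^ᶠ-inhabited {suc m} _ = zeroˡ _
  ... | no  a≢0 = *-cancelʳ (Π-≢0 (nonzero ∘ element) (nonzero≢0 ∘ element)) (begin
    a ^ᶠ N * P
      ≡⟨ cong (_* P) (sym (Π-const N a)) ⟩
    Π {N} (λ _ → a) * P
      ≡⟨ sym (Product.∑-distrib-+ (λ _ → a) (nonzero ∘ element)) ⟩
    Π (λ i → a * nonzero (element i))
      ≡⟨ Product.sum-cong-≗ (sym ∘ nonzero-scale a≢0 ∘ element) ⟩
    Π (λ i → nonzero (a * element i) * atZero a (element i))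
      ≡⟨ Product.∑-distrib-+ _ (atZero a ∘ element) ⟩
    Π (nonzero ∘ (a *_) ∘ element) * Π (atZero a ∘ element)
      ≡⟨ cong₂ _*_ (sym (Π-reindex (a *_) (a⁻¹ *_) cancel cancel' nonzero)) single ⟩
    P * a
      ≡⟨ *-comm P a ⟩
    a * P ∎)
    where
    open ≡-Reasoning
    P a⁻¹ : Carrier
    P = Π (nonzero ∘ element)
    a⁻¹ = proj₁ (inverse a a≢0)
    aa⁻¹≡1 : a * a⁻¹ ≡ 1#
    aa⁻¹≡1 = proj₂ (inverse a a≢0)
    cancel : ∀ x → a * (a⁻¹ * x) ≡ x
    cancel x = trans (sym (*-assoc a a⁻¹ x)) (trans (cong (_* x) aa⁻¹≡1) (*-identityˡ x))
    cancel' : ∀ x → a⁻¹ * (a * x) ≡ x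
    cancel' x = trans (sym (*-assoc a⁻¹ a x)) (trans (cong (_* x) (trans (*-comm a⁻¹ a) aa⁻¹≡1)) (*-identityˡ x))
    single : Π (atZero a ∘ element) ≡ a
    single = trans (sum-single *-monoid (atZero a ∘ element) (index 0#) (atZero-element a))
                   (trans (cong (atZero a) (element-index 0#)) (atZero-zero a))

module PolynomialRoots {N : ℕ} (F : FiniteField N) where

  open FieldArithmetic F
  open FieldSums F
  import Data.Nat.Properties as ℕP
  open import Data.List using (List; []; _∷_; length; tabulate)
  open import Data.List.Relation.Unary.All using (All; []; _∷_)
  open import Data.List.Relation.Unary.All.Properties using (tabulate⁻)
  open import Data.List.Properties using (length-tabulate)

  -- Polynomials as coefficient lists, constant term first.
  eval : List Carrier → Carrier → Carrier
  eval []       z = 0#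
  eval (c ∷ cs) z = c + z * eval cs z

  -- Synthetic division by z - r: the remainder is eval cs r.
  quotient : Carrier → List Carrier → List Carrier
  quotient r []           = []
  quotient r (c ∷ [])     = []
  quotient r (c ∷ d ∷ ds) = eval (d ∷ ds) r ∷ quotient r (d ∷ ds)

  eval-quotient : ∀ r cs z → eval cs z ≡ (z - r) * eval (quotient r cs) z + eval cs r
  eval-quotient r []           z = solve 2 (λ z r → con 0ℤ := (z :- r) :* con 0ℤ :+ con 0ℤ) refl z r
  eval-quotient r (c ∷ [])     z = solve 3 (λ c z r → c :+ z :* con 0ℤ := (z :- r) :* con 0ℤ :+ (c :+ r :* con 0ℤ)) refl c z r
  eval-quotient r (c ∷ d ∷ ds) z = trans (cong (λ t → c + z * t) (eval-quotient r (d ∷ ds) z))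
    (solve 5 (λ c z r q s → c :+ z :* ((z :- r) :* q :+ s) := (z :- r) :* (s :+ z :* q) :+ (c :+ r :* s))
      refl c z r (eval (quotient r (d ∷ ds)) z) (eval (d ∷ ds) r))

  length-quotient : ∀ r c cs → length (quotient r (c ∷ cs)) ≡ length cs
  length-quotient r c []       = refl
  length-quotient r c (d ∷ ds) = cong suc (length-quotient r d ds)

  IsZero : List Carrier → Set
  IsZero = All (_≡ 0#)

  const-term-zero : ∀ {r c s} → s ≡ 0# → c + r * s ≡ 0# → c ≡ 0#
  const-term-zero {r} {c} refl e = trans (solve 2 (λ c r → c := c :+ r :* con 0ℤ) refl c r) e

  quotient-root-isZero : ∀ r cs → IsZero (quotient r cs) → eval cs r ≡ 0# → IsZero cs
  quotient-root-isZero r []           _        _    = []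
  quotient-root-isZero r (c ∷ [])     _        root = const-term-zero refl root ∷ []
  quotient-root-isZero r (c ∷ d ∷ ds) (q ∷ qs) root = const-term-zero q root ∷ quotient-root-isZero r (d ∷ ds) qs q

  vanishing⇒isZero : ∀ m (points : Fin m → Carrier) → (∀ {i j} → points i ≡ points j → i ≡ j) →
                     ∀ cs → length cs ℕ.≤ m → (∀ i → eval cs (points i) ≡ 0#) → IsZero cs
  vanishing⇒isZero m       points inj []       _              _        = []
  vanishing⇒isZero (suc m) points inj (c ∷ cs) (ℕ.s≤s len≤m) vanishes =
    quotient-root-isZero r (c ∷ cs)
      (vanishing⇒isZero m (points ∘ Fin.suc) (FinP.suc-injective ∘ inj) (quotient r (c ∷ cs))
        (subst (ℕ._≤ m) (sym (length-quotient r c cs)) len≤m) quotient-vanishes)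
      (vanishes Fin.zero)
    where
    r : Carrier
    r = points Fin.zero
    quotient-vanishes : ∀ i → eval (quotient r (c ∷ cs)) (points (Fin.suc i)) ≡ 0#
    quotient-vanishes i = x*y≡0⇒y≡0 ((λ ()) ∘ inj ∘ x-y≡0⇒x≡y) (begin
      (z - r) * eval (quotient r (c ∷ cs)) z
        ≡⟨ sym (+-identityʳ _) ⟩
      (z - r) * eval (quotient r (c ∷ cs)) z + 0#
        ≡⟨ cong ((z - r) * eval (quotient r (c ∷ cs)) z +_) (sym (vanishes Fin.zero)) ⟩
      (z - r) * eval (quotient r (c ∷ cs)) z + eval (c ∷ cs) r
        ≡⟨ sym (eval-quotient r (c ∷ cs) z) ⟩
      eval (c ∷ cs) z
        ≡⟨ vanishes (Fin.suc i) ⟩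
      0# ∎)
      where
      open ≡-Reasoning
      z : Carrier
      z = points (Fin.suc i)

  eval-tabulate : ∀ {n} (f : Fin n → Carrier) z → eval (tabulate f) z ≡ Σ (λ k → f k * z ^ᶠ toℕ k)
  eval-tabulate {zero}  f z = refl
  eval-tabulate {suc n} f z = begin
    f Fin.zero + z * eval (tabulate (f ∘ Fin.suc)) z
      ≡⟨ cong (λ t → f Fin.zero + z * t) (eval-tabulate (f ∘ Fin.suc) z) ⟩
    f Fin.zero + z * Σ (λ k → f (Fin.suc k) * z ^ᶠ toℕ k)
      ≡⟨ cong₂ _+_ (sym (*-identityʳ (f Fin.zero))) (*-Σ z (λ k → f (Fin.suc k) * z ^ᶠ toℕ k)) ⟩
    f Fin.zero * 1# + Σ (λ k → z * (f (Fin.suc k) * z ^ᶠ toℕ k))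
      ≡⟨ cong (_ +_) (Σ-cong (λ k → solve 3 (λ z a b → z :* (a :* b) := a :* (z :* b)) refl z (f (Fin.suc k)) (z ^ᶠ toℕ k))) ⟩
    f Fin.zero * 1# + Σ (λ k → f (Fin.suc k) * (z * z ^ᶠ toℕ k)) ∎
    where open ≡-Reasoning

  monomials-independent : ∀ {m} (d : Fin m → Carrier) (e : Fin m → ℕ) →
                          (∀ {i j} → e i ≡ e j → i ≡ j) → (∀ i → e i ℕ.< N) →
                          (∀ z → Σ (λ i → d i * z ^ᶠ e i) ≡ 0#) → ∀ j → d j ≡ 0#
  monomials-independent {m} d e e-injective e<N vanishes j = begin
    d j                 ≡⟨ sym (trans (Σ-single _ j off-j) (at-≡ (e j) (d j))) ⟩
    coefficient (e j)   ≡⟨ cong coefficient (sym (FinP.toℕ-fromℕ< (e<N j))) ⟩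
    coefficient (toℕ k) ≡⟨ tabulate⁻ polynomial≡0 k ⟩
    0#                  ∎
    where
    open ≡-Reasoning
    coefficient : ℕ → Carrier
    coefficient a = Σ (λ i → at (e i) (d i) a)
    polynomial : List Carrier
    polynomial = tabulate {n = N} (coefficient ∘ toℕ)
    k : Fin N
    k = Fin.fromℕ< (e<N j)
    off-j : ∀ i → i ≢ j → at (e i) (d i) (e j) ≡ 0#
    off-j i i≢j = at-≢ (d i) (i≢j ∘ e-injective ∘ sym)
    eval-polynomial : ∀ z → eval polynomial z ≡ Σ (λ i → d i * z ^ᶠ e i)
    eval-polynomial z = begin
      eval polynomial z
        ≡⟨ eval-tabulate {N} (coefficient ∘ toℕ) z ⟩
      Σ {N} (λ a → coefficient (toℕ a) * z ^ᶠ toℕ a)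
        ≡⟨ Σ-cong {N} (λ a → Σ-*ʳ (λ i → at (e i) (d i) (toℕ a)) (z ^ᶠ toℕ a)) ⟩
      Σ {N} (λ a → Σ {m} (λ i → at (e i) (d i) (toℕ a) * z ^ᶠ toℕ a))
        ≡⟨ Σ-comm {N} {m} (λ a i → at (e i) (d i) (toℕ a) * z ^ᶠ toℕ a) ⟩
      Σ (λ i → Σ {N} (λ a → at (e i) (d i) (toℕ a) * z ^ᶠ toℕ a))
        ≡⟨ Σ-cong {m} (λ i → Σ-at (e<N i) (λ a u → u * z ^ᶠ a) (λ a → zeroˡ _) (d i)) ⟩
      Σ (λ i → d i * z ^ᶠ e i) ∎
    polynomial≡0 : IsZero polynomial
    polynomial≡0 = vanishing⇒isZero N element element-injective polynomial (ℕP.≤-reflexive (length-tabulate _))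
                     (λ i → trans (eval-polynomial (element i)) (vanishes (element i)))

module Frobenius {N : ℕ} (F : FiniteField N) {p n : ℕ} (p-prime : Prime p) (N≡pⁿ : N ≡ p ℕ.^ n) where

  open FieldArithmetic F
  open FieldSums F
  open CharacteristicAndFermat F
  open PolynomialRoots F
  open import Data.Nat.Properties as ℕP using (^-distribˡ-+-*; m+[n∸m]≡n; m∸n+n≡m)
  open import Data.Nat.DivMod using (_%_; _/_; m≡m%n+[m/n]*n)
  open import Relation.Binary.Definitions using (tri<; tri≈; tri>)

  frob : ℕ → Carrier → Carrier
  frob m z = z ^ᶠ (p ℕ.^ m)

  frob-zero : ∀ z → frob 0 z ≡ z
  frob-zero = *-identityʳ

  frob-∘ : ∀ a b z → frob a (frob b z) ≡ frob (b ℕ.+ a) z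
  frob-∘ a b z = trans (sym (^ᶠ-* z (p ℕ.^ b) (p ℕ.^ a))) (cong (z ^ᶠ_) (sym (^-distribˡ-+-* p b a)))

  frob-+ : ∀ m x y → frob m (x + y) ≡ frob m x + frob m y
  frob-+ zero    x y = trans (frob-zero _) (sym (cong₂ _+_ (frob-zero x) (frob-zero y)))
  frob-+ (suc m) x y = begin
    frob (suc m) (x + y)                ≡⟨ frob-suc (x + y) ⟩
    frob m ((x + y) ^ᶠ p)               ≡⟨ cong (frob m) (frobenius-+ p-prime (nat-p≡0 p n N≡pⁿ) x y) ⟩
    frob m (x ^ᶠ p + y ^ᶠ p)            ≡⟨ frob-+ m _ _ ⟩
    frob m (x ^ᶠ p) + frob m (y ^ᶠ p)   ≡⟨ sym (cong₂ _+_ (frob-suc x) (frob-suc y)) ⟩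
    frob (suc m) x + frob (suc m) y     ∎
    where
    open ≡-Reasoning
    frob-suc : ∀ z → frob (suc m) z ≡ frob m (z ^ᶠ p)
    frob-suc z = ^ᶠ-* z p (p ℕ.^ m)

  frob-* : ∀ m x y → frob m (x * y) ≡ frob m x * frob m y
  frob-* m x y = *-^ᶠ x y (p ℕ.^ m)

  frob-0# : ∀ m → frob m 0# ≡ 0#
  frob-0# m = x+x≈x⇒x≈0 (frob m 0#) (trans (sym (frob-+ m 0# 0#)) (cong (frob m) (+-identityʳ 0#)))

  frob-- : ∀ m x → frob m (- x) ≡ - frob m x
  frob-- m x = +-inverseʳ-unique (frob m x) (frob m (- x))
    (trans (sym (frob-+ m x (- x))) (trans (cong (frob m) (-‿inverseʳ x)) (frob-0# m)))

  frob-n : ∀ z → frob n z ≡ z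
  frob-n z = trans (cong (z ^ᶠ_) (sym N≡pⁿ)) (fermat z)

  frob-multiple : ∀ q z → frob (q ℕ.* n) z ≡ z
  frob-multiple zero    z = frob-zero z
  frob-multiple (suc q) z = trans (sym (frob-∘ (q ℕ.* n) n z)) (trans (frob-multiple q (frob n z)) (frob-n z))

  frob-mod : ∀ m z .{{_ : ℕ.NonZero n}} → frob m z ≡ frob (m % n) z
  frob-mod m z = begin
    frob m z                                ≡⟨ cong (λ a → frob a z) (m≡m%n+[m/n]*n m n) ⟩
    frob (m % n ℕ.+ (m / n) ℕ.* n) z        ≡⟨ sym (frob-∘ ((m / n) ℕ.* n) (m % n) z) ⟩
    frob ((m / n) ℕ.* n) (frob (m % n) z)   ≡⟨ frob-multiple (m / n) _ ⟩
    frob (m % n) z                          ∎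
    where open ≡-Reasoning

  frob-inverseˡ : ∀ {a} → a ℕ.≤ n → ∀ z → frob (n ∸ a) (frob a z) ≡ z
  frob-inverseˡ {a} a≤n z = trans (frob-∘ (n ∸ a) a z) (trans (cong (λ b → frob b z) (m+[n∸m]≡n a≤n)) (frob-n z))

  frob-inverseʳ : ∀ {a} → a ℕ.≤ n → ∀ z → frob a (frob (n ∸ a) z) ≡ z
  frob-inverseʳ {a} a≤n z = trans (frob-∘ a (n ∸ a) z) (trans (cong (λ b → frob b z) (m∸n+n≡m a≤n)) (frob-n z))

  private
    1<p : 1 ℕ.< p
    1<p = PrimeBinomial.prime≥2 p-prime

    p^-injective : ∀ {a b} → p ℕ.^ a ≡ p ℕ.^ b → a ≡ b
    p^-injective {a} {b} pᵃ≡pᵇ with ℕP.<-cmp a b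
    ... | tri< a<b _ _ = ⊥-elim (ℕP.<⇒≢ (ℕP.^-monoʳ-< p 1<p a<b) pᵃ≡pᵇ)
    ... | tri≈ _ a≡b _ = a≡b
    ... | tri> _ _ b<a = ⊥-elim (ℕP.<⇒≢ (ℕP.^-monoʳ-< p 1<p b<a) (sym pᵃ≡pᵇ))

  linPoly-unique : ∀ (c c′ : Fin n → Carrier) → (∀ z → linPoly p c z ≡ linPoly p c′ z) → ∀ i → c i ≡ c′ i
  linPoly-unique c c′ c≗c′ i = x-y≡0⇒x≡y
    (monomials-independent (λ i → c i - c′ i) (λ i → p ℕ.^ toℕ i) (FinP.toℕ-injective ∘ p^-injective)
      (λ i → subst (p ℕ.^ toℕ i ℕ.<_) (sym N≡pⁿ) (ℕP.^-monoʳ-< p 1<p (FinP.toℕ<n i))) difference-vanishes i)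
    where
    difference-vanishes : ∀ z → Σ (λ i → (c i - c′ i) * frob (toℕ i) z) ≡ 0#
    difference-vanishes z = begin
      Σ (λ i → (c i - c′ i) * frob (toℕ i) z)
        ≡⟨ Σ-cong (λ i → solve 3 (λ a b w → (a :- b) :* w := a :* w :- b :* w) refl (c i) (c′ i) (frob (toℕ i) z)) ⟩
      Σ (λ i → c i * frob (toℕ i) z - c′ i * frob (toℕ i) z)
        ≡⟨ Σ-- (λ i → c i * frob (toℕ i) z) (λ i → c′ i * frob (toℕ i) z) ⟩
      linPoly p c z - linPoly p c′ z
        ≡⟨ cong (λ t → linPoly p c z - t) (sym (c≗c′ z)) ⟩
      linPoly p c z - linPoly p c z
        ≡⟨ -‿inverseʳ _ ⟩
      0# ∎
      where open ≡-Reasoning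

module TransposeDual {N : ℕ} (F : FiniteField N) {p n : ℕ} (p-prime : Prime p) (N≡pⁿ : N ≡ p ℕ.^ n)
  {q ℓ d K D : ℕ} (qˡ≡pᴷ : q ℕ.^ ℓ ≡ p ℕ.^ K) (qᵈ≡pᴰ : q ℕ.^ d ≡ p ℕ.^ D)
  (q^[2ℓ∸d]≡p^[n∸D] : q ℕ.^ (2 ℕ.* ℓ ∸ d) ≡ p ℕ.^ (n ∸ D))
  (n≡K+K : n ≡ K ℕ.+ K) (K<n : K ℕ.< n) (D<n : D ℕ.< n) where

  open FieldArithmetic F
  open FieldSums F
  open Frobenius F {p} {n} p-prime N≡pⁿ
  open import Data.Nat.Properties as ℕP using (<⇒≤; m+n∸m≡n)
  open import Data.Nat.DivMod using (_%_; m%n<n)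
  open import Data.List using (List; []; _∷_)
  open import Data.List.Relation.Unary.All using (All; []; _∷_)

  instance
    n-nonZero : ℕ.NonZero n
    n-nonZero = ℕ.>-nonZero (ℕP.m<n⇒0<n K<n)

  M : ℕ
  M = (D ℕ.+ K) % n

  frob-K∘K : ∀ t → frob K (frob K t) ≡ t
  frob-K∘K t = trans (frob-∘ K K t) (trans (cong (λ a → frob a t) (sym n≡K+K)) (frob-n t))

  frob-K∘D : ∀ t → frob K (frob D t) ≡ frob M t
  frob-K∘D t = trans (frob-∘ K D t) (frob-mod (D ℕ.+ K) t)

  frob-K∘M : ∀ t → frob K (frob M t) ≡ frob D t
  frob-K∘M t = trans (cong (frob K) (sym (frob-K∘D t))) (frob-K∘K (frob D t))

  frob-[n∸M]∘K : ∀ t → frob (n ∸ M) (frob K t) ≡ frob (n ∸ D) t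
  frob-[n∸M]∘K t = begin
    frob (n ∸ M) (frob K t)                          ≡⟨ cong (frob (n ∸ M) ∘ frob K) (sym (frob-inverseʳ (<⇒≤ D<n) t)) ⟩
    frob (n ∸ M) (frob K (frob D (frob (n ∸ D) t)))  ≡⟨ cong (frob (n ∸ M)) (frob-K∘D _) ⟩
    frob (n ∸ M) (frob M (frob (n ∸ D) t))           ≡⟨ frob-inverseˡ (<⇒≤ (m%n<n (D ℕ.+ K) n)) _ ⟩
    frob (n ∸ D) t                                   ∎
    where open ≡-Reasoning

  frob-+* : ∀ m a b c → frob m (a + b * c) ≡ frob m a + frob m b * frob m c
  frob-+* m a b c = trans (frob-+ m a (b * c)) (cong (frob m a +_) (frob-* m b c))

  frob-** : ∀ m a b c → frob m (a * b * c) ≡ frob m a * frob m b * frob m c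
  frob-** m a b c = trans (frob-* m (a * b) c) (cong (_* frob m c) (frob-* m a b))

  module _ (β ω x : Carrier) where

    X₁ X₂ X₃ β₁ : Carrier
    X₁ = frob K x
    X₂ = frob D x
    X₃ = frob M x
    β₁ = frob K β

    terms : List (ℕ × Carrier)
    terms = (0 , X₁ + β * X₂ * ω) ∷ (K , x + β₁ * X₃ * ω) ∷ (D , β * x * ω) ∷ (M , β₁ * X₁ * ω) ∷ []

    terms<n : All (λ tv → proj₁ tv ℕ.< n) terms
    terms<n = ℕP.m<n⇒0<n K<n ∷ K<n ∷ D<n ∷ m%n<n (D ℕ.+ K) n ∷ []

    starB-linearized : ∀ z → starB q ℓ d β ω z x ≡ linPoly p {n} (sparse terms ∘ toℕ) z
    starB-linearized z = begin
      starB q ℓ d β ω z x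
        ≡⟨ cong₂ (λ Q Q′ → z * x ^ᶠ Q + z ^ᶠ Q * x
                           + (β * (z * x ^ᶠ Q′ + z ^ᶠ Q′ * x) + β ^ᶠ Q * (z * x ^ᶠ Q′ + z ^ᶠ Q′ * x) ^ᶠ Q) * ω)
                 qˡ≡pᴷ qᵈ≡pᴰ ⟩
      z * X₁ + frob K z * x + (β * (z * X₂ + frob D z * x) + β₁ * frob K (z * X₂ + frob D z * x)) * ω
        ≡⟨ cong (λ t → z * X₁ + frob K z * x + (β * (z * X₂ + frob D z * x) + β₁ * t) * ω) frob-K-u ⟩
      z * X₁ + frob K z * x + (β * (z * X₂ + frob D z * x) + β₁ * (frob K z * X₃ + frob M z * X₁)) * ω
        ≡⟨ solve 11 (λ z zK zD zM x X₁ X₂ X₃ β β₁ ω →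
             z :* X₁ :+ zK :* x :+ (β :* (z :* X₂ :+ zD :* x) :+ β₁ :* (zK :* X₃ :+ zM :* X₁)) :* ω
             := (X₁ :+ β :* X₂ :* ω) :* (z :* con 1ℤ) :+ ((x :+ β₁ :* X₃ :* ω) :* zK
                :+ ((β :* x :* ω) :* zD :+ ((β₁ :* X₁ :* ω) :* zM :+ con 0ℤ))))
             refl z (frob K z) (frob D z) (frob M z) x X₁ X₂ X₃ β β₁ ω ⟩
      sumTerms (λ t v → v * frob t z) terms
        ≡⟨ sym (Σ-sparse {n} (λ t v → v * frob t z) (λ t → zeroˡ _) (λ t u v → distribʳ _ u v) terms terms<n) ⟩
      linPoly p {n} (sparse terms ∘ toℕ) z ∎
      where
      open ≡-Reasoning
      frob-K-u : frob K (z * X₂ + frob D z * x) ≡ frob K z * X₃ + frob M z * X₁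
      frob-K-u = trans (frob-+ K _ _) (cong₂ _+_ (trans (frob-* K z X₂) (cong (frob K z *_) (frob-K∘D x)))
                                                  (trans (frob-* K (frob D z) x) (cong (_* X₁) (frob-K∘D z))))

    module _ (A B : Carrier) (ω-conj : frob K ω ≡ - ω) (A-fixed : frob K A ≡ A) (B-fixed : frob K B ≡ B) where

      y : Carrier
      y = A + B * ω

      conjTerm : ℕ → Carrier → Carrier
      conjTerm t v = frob (n ∸ t) v * frob (n ∸ t) y

      conjPoly-linearized : conjPoly p {n} (sparse terms ∘ toℕ) y ≡ sumTerms conjTerm terms
      conjPoly-linearized = Σ-sparse {n} conjTerm
        (λ t → trans (cong (_* frob (n ∸ t) y) (frob-0# (n ∸ t))) (zeroˡ _))
        (λ t u v → trans (cong (_* frob (n ∸ t) y) (frob-+ (n ∸ t) u v)) (distribʳ _ _ _))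
        terms terms<n

      E : ℕ
      E = n ∸ D

      βᴱ xᴱ ωᴱ Aᴱ Bᴱ : Carrier
      βᴱ = frob E β
      xᴱ = frob E x
      ωᴱ = frob E ω
      Aᴱ = frob E A
      Bᴱ = frob E B

      conjTerm-0 : conjTerm 0 (X₁ + β * X₂ * ω) ≡ (X₁ + β * X₂ * ω) * (A + B * ω)
      conjTerm-0 = cong₂ _*_ (frob-n _) (frob-n y)

      conjTerm-K : conjTerm K (x + β₁ * X₃ * ω) ≡ (X₁ + β * X₂ * - ω) * (A + B * - ω)
      conjTerm-K = begin
        frob (n ∸ K) (x + β₁ * X₃ * ω) * frob (n ∸ K) y
          ≡⟨ cong (λ a → frob a (x + β₁ * X₃ * ω) * frob a y) n∸K≡K ⟩
        frob K (x + β₁ * X₃ * ω) * frob K y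
          ≡⟨ cong₂ _*_ (frob-+* K x (β₁ * X₃) ω) (frob-+* K A B ω) ⟩
        (X₁ + frob K (β₁ * X₃) * frob K ω) * (frob K A + frob K B * frob K ω)
          ≡⟨ cong₂ _*_ (cong₂ (λ u w → X₁ + u * w) β₁X₃ᴷ ω-conj) (cong₂ _+_ A-fixed (cong₂ _*_ B-fixed ω-conj)) ⟩
        (X₁ + β * X₂ * - ω) * (A + B * - ω) ∎
        where
        open ≡-Reasoning
        n∸K≡K : n ∸ K ≡ K
        n∸K≡K = trans (cong (_∸ K) n≡K+K) (m+n∸m≡n K K)
        β₁X₃ᴷ : frob K (β₁ * X₃) ≡ β * X₂
        β₁X₃ᴷ = trans (frob-* K β₁ X₃) (cong₂ _*_ (frob-K∘K β) (frob-K∘M x))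

      conjTerm-D : conjTerm D (β * x * ω) ≡ (βᴱ * xᴱ * ωᴱ) * (Aᴱ + Bᴱ * ωᴱ)
      conjTerm-D = cong₂ _*_ (frob-** E β x ω) (frob-+* E A B ω)

      conjTerm-M : conjTerm M (β₁ * X₁ * ω) ≡ (βᴱ * xᴱ * - ωᴱ) * (Aᴱ + Bᴱ * - ωᴱ)
      conjTerm-M = cong₂ _*_
        (trans (frob-** (n ∸ M) β₁ X₁ ω) (cong₂ _*_ (cong₂ _*_ (frob-[n∸M]∘K β) (frob-[n∸M]∘K x)) ωᴹ))
        (trans (frob-+* (n ∸ M) A B ω) (cong₂ _+_ (fixedᴹ A A-fixed) (cong₂ _*_ (fixedᴹ B B-fixed) ωᴹ)))
        where
        open ≡-Reasoning
        ωᴹ : frob (n ∸ M) ω ≡ - ωᴱ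
        ωᴹ = begin
          frob (n ∸ M) ω               ≡⟨ cong (frob (n ∸ M)) (sym (trans (cong -_ ω-conj) (-‿involutive ω))) ⟩
          frob (n ∸ M) (- frob K ω)    ≡⟨ frob-- (n ∸ M) (frob K ω) ⟩
          - frob (n ∸ M) (frob K ω)    ≡⟨ cong -_ (frob-[n∸M]∘K ω) ⟩
          - ωᴱ                         ∎
        fixedᴹ : ∀ t → frob K t ≡ t → frob (n ∸ M) t ≡ frob E t
        fixedᴹ t t-fixed = trans (cong (frob (n ∸ M)) (sym t-fixed)) (frob-[n∸M]∘K t)

      sumTerms-conjTerm≡starFormula : sumTerms conjTerm terms ≡ starFormula q ℓ d β ω x A B
      sumTerms-conjTerm≡starFormula = begin
        sumTerms conjTerm terms
          ≡⟨ cong₂ _+_ conjTerm-0 (cong₂ _+_ conjTerm-K (cong₂ (λ a b → a + (b + 0#)) conjTerm-D conjTerm-M)) ⟩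
        (X₁ + β * X₂ * ω) * (A + B * ω) + ((X₁ + β * X₂ * - ω) * (A + B * - ω)
          + ((βᴱ * xᴱ * ωᴱ) * (Aᴱ + Bᴱ * ωᴱ) + ((βᴱ * xᴱ * - ωᴱ) * (Aᴱ + Bᴱ * - ωᴱ) + 0#)))
          ≡⟨ solve 11 (λ X₁ X₂ β ω A B βᴱ xᴱ ωᴱ Aᴱ Bᴱ →
               (X₁ :+ β :* X₂ :* ω) :* (A :+ B :* ω) :+ ((X₁ :+ β :* X₂ :* :- ω) :* (A :+ B :* :- ω)
                 :+ ((βᴱ :* xᴱ :* ωᴱ) :* (Aᴱ :+ Bᴱ :* ωᴱ) :+ ((βᴱ :* xᴱ :* :- ωᴱ) :* (Aᴱ :+ Bᴱ :* :- ωᴱ) :+ con 0ℤ)))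
               := (con 1ℤ :+ con 1ℤ) :* A :* X₁ :+ (con 1ℤ :+ con 1ℤ) :* (ωᴱ :* ωᴱ) :* βᴱ :* Bᴱ :* xᴱ
                  :+ (con 1ℤ :+ con 1ℤ) :* (ω :* ω) :* β :* B :* X₂)
               refl X₁ X₂ β ω A B βᴱ xᴱ ωᴱ Aᴱ Bᴱ ⟩
        two * A * X₁ + two * (ωᴱ * ωᴱ) * βᴱ * Bᴱ * xᴱ + two * (ω * ω) * β * B * X₂
          ≡⟨ cong (λ s → two * A * X₁ + two * s * βᴱ * Bᴱ * xᴱ + two * (ω * ω) * β * B * X₂) (sym (frob-* E ω ω)) ⟩
        formula (p ℕ.^ K) (p ℕ.^ E) (p ℕ.^ D)
          ≡⟨ sym (cong₂ (λ Q e → formula Q e (p ℕ.^ D)) qˡ≡pᴷ q^[2ℓ∸d]≡p^[n∸D]) ⟩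
        formula (q ℕ.^ ℓ) (q ℕ.^ (2 ℕ.* ℓ ∸ d)) (p ℕ.^ D)
          ≡⟨ sym (cong (formula (q ℕ.^ ℓ) (q ℕ.^ (2 ℕ.* ℓ ∸ d))) qᵈ≡pᴰ) ⟩
        starFormula q ℓ d β ω x A B
          ∎
        where
        open ≡-Reasoning
        formula : ℕ → ℕ → ℕ → Carrier
        formula Q e Q′ = two * A * x ^ᶠ Q + two * (ω * ω) ^ᶠ e * β ^ᶠ e * B ^ᶠ e * x ^ᶠ e + two * (ω * ω) * β * B * x ^ᶠ Q′

      transposeDual-formula : (c : Fin n → Carrier) → (∀ z → starB q ℓ d β ω z x ≡ linPoly p c z) →
                              conjPoly p c y ≡ starFormula q ℓ d β ω x A B
      transposeDual-formula c c-represents = begin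
        conjPoly p c y
          ≡⟨ Σ-cong {n} (λ i → cong (λ u → frob (n ∸ toℕ i) u * frob (n ∸ toℕ i) y) (c≗terms i)) ⟩
        conjPoly p {n} (sparse terms ∘ toℕ) y
          ≡⟨ conjPoly-linearized ⟩
        sumTerms conjTerm terms
          ≡⟨ sumTerms-conjTerm≡starFormula ⟩
        starFormula q ℓ d β ω x A B ∎
        where
        open ≡-Reasoning
        c≗terms : ∀ i → c i ≡ sparse terms (toℕ i)
        c≗terms = linPoly-unique c (sparse terms ∘ toℕ) (λ z → trans (sym (c-represents z)) (starB-linearized z))

open import Data.Nat using (_^_; _*_; _+_; _<_; _≤_)
open import Data.Nat.Divisibility using (_∣_)
open import Data.Nat.GCD using (gcd)
open FiniteField using (Carrier)
open FiniteField {{...}} using (_^ᶠ_; -_; IsSquare; starB; linPoly; conjPoly; starFormula) renaming (_+_ to _+ᶠ_; _*_ to _*ᶠ_)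

proposition4p2 :
    (p k ℓ d : ℕ) → Prime p → 1 ≤ k → ¬ (2 ∣ p ^ k) →
    0 < d → d < 2 * ℓ → ¬ (2 ∣ ℓ + d) → gcd ℓ d ≡ 1 →
    {{F : FiniteField (p ^ (k * (2 * ℓ)))}} →
    (ω β : Carrier F) →
       ¬ (ω ^ᶠ ((p ^ k) ^ ℓ) ≡ ω) → ω ^ᶠ ((p ^ k) ^ ℓ) ≡ - ω →
       ¬ IsSquare β →
       (x A B : Carrier F) → A ^ᶠ ((p ^ k) ^ ℓ) ≡ A → B ^ᶠ ((p ^ k) ^ ℓ) ≡ B →
       (c : Fin (k * (2 * ℓ)) → Carrier F) →
       ((z : Carrier F) → starB (p ^ k) ℓ d β ω z x ≡ linPoly p c z) →
       conjPoly p c (A +ᶠ B *ᶠ ω) ≡ starFormula (p ^ k) ℓ d β ω x A B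
proposition4p2 p k ℓ d p-prime 1≤k _ _ d<2ℓ _ _ {{F}} ω β _ ω-conj _ x A B A-fixed B-fixed c c-represents =
  TransposeDual.transposeDual-formula F {p} {k * (2 * ℓ)} p-prime refl {p ^ k} {ℓ} {d} {k * ℓ} {k * d}
    qˡ≡pᴷ qᵈ≡pᴰ q^[2ℓ∸d]≡p^[n∸D] n≡K+K K<n D<n β ω x A B (to-pᴷ ω-conj) (to-pᴷ A-fixed) (to-pᴷ B-fixed) c c-represents
  where
  open import Data.Nat.Properties using (^-*-assoc; *-distribˡ-∸; *-distribˡ-+; +-identityʳ; *-monoʳ-<; m<m+n)
  instance
    k-nonZero : ℕ.NonZero k
    k-nonZero = ℕ.>-nonZero 1≤k
  qˡ≡pᴷ : (p ^ k) ^ ℓ ≡ p ^ (k * ℓ)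
  qˡ≡pᴷ = ^-*-assoc p k ℓ
  qᵈ≡pᴰ : (p ^ k) ^ d ≡ p ^ (k * d)
  qᵈ≡pᴰ = ^-*-assoc p k d
  q^[2ℓ∸d]≡p^[n∸D] : (p ^ k) ^ (2 * ℓ ∸ d) ≡ p ^ (k * (2 * ℓ) ∸ k * d)
  q^[2ℓ∸d]≡p^[n∸D] = trans (^-*-assoc p k (2 * ℓ ∸ d)) (cong (p ^_) (*-distribˡ-∸ k (2 * ℓ) d))
  n≡K+K : k * (2 * ℓ) ≡ k * ℓ + k * ℓ
  n≡K+K = trans (*-distribˡ-+ k ℓ (ℓ + 0)) (cong (λ t → k * ℓ + k * t) (+-identityʳ ℓ))
  ℓ<2ℓ : ∀ {ℓ} → d < 2 * ℓ → ℓ < 2 * ℓ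
  ℓ<2ℓ {suc ℓ} _ = m<m+n (suc ℓ) ℕ.z<s
  K<n : k * ℓ < k * (2 * ℓ)
  K<n = *-monoʳ-< k (ℓ<2ℓ d<2ℓ)
  D<n : k * d < k * (2 * ℓ)
  D<n = *-monoʳ-< k d<2ℓ
  to-pᴷ : ∀ {u v : Carrier F} → u ^ᶠ ((p ^ k) ^ ℓ) ≡ v → u ^ᶠ (p ^ (k * ℓ)) ≡ v
  to-pᴷ {u} {v} = subst (λ e → u ^ᶠ e ≡ v) qˡ≡pᴷ
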